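{- There is a deterministic multi-pass streaming algorithm which, given an integer $k \ge 1$ and an $n$-vertex undirected graph $G$ whose edges arrive as an insertion-only stream (in the same order in every pass), makes at most $2^{k}$ passes over the stream, stores $O(k\log n)$ bits, and correctly outputs a vertex cover of $G$ of size at most $k$ if one exists, and outputs NO otherwise.
   Context: Streaming model: the vertex set $V$ of $G$ (with $|V|=n$) is fixed and known; the edges of $G$ are presented one by one in a stream (insertion-only: edges are only inserted). In a multi-pass algorithm the stream is read several times, each time in the same order. The algorithm may perform unbounded computation; its space is the number of bits it stores. A vertex cover of $G$ is a set $S\subseteq V$ containing at least one endpoint of every edge. -}

module Defs where

open import Data.Nat using (ℕ; zero; suc; _+_; _*_; _^_; _≤_)
open import Data.Nat.Logarithm using (⌈log₂_⌉)
open import Data.Fin using (Fin)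
open import Data.Bool using (Bool)
open import Data.List using (List; []; _∷_; _++_; foldl; scanl; length)
open import Data.List.Relation.Unary.All using (All)
open import Data.List.Relation.Unary.AllPairs using (AllPairs)
open import Data.List.Membership.Propositional using (_∈_)
open import Data.Maybe using (Maybe; just; nothing)
open import Data.Product using (_×_; _,_; proj₁; proj₂; Σ; ∃; swap)
open import Data.Sum using (_⊎_; inj₁; inj₂)
open import Relation.Nullary using (¬_)
open import Data.Empty using (⊥)
open import Relation.Binary.PropositionalEquality using (_≡_; _≢_)

-- Vertices of an n-vertex graph are Fin n; an undirected edge {u,v} is
-- presented in the stream as an (arbitrarily oriented) pair (u , v).
Edge : ℕ → Set
Edge n = Fin n × Fin n

Stream : ℕ → Set
Stream n = List (Edge n)

SameEdge : ∀ {n} → Edge n → Edge n → Set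
SameEdge e f = (e ≡ f) ⊎ (swap e ≡ f)

SimpleGraphStream : ∀ {n} → Stream n → Set
SimpleGraphStream es =
  All (λ e → proj₁ e ≢ proj₂ e) es × AllPairs (λ e f → ¬ SameEdge e f) es

IsVertexCover : ∀ {n} → Stream n → List (Fin n) → Set
IsVertexCover es S = All (λ e → (proj₁ e ∈ S) ⊎ (proj₂ e ∈ S)) es

-- Output of the algorithm: nothing = "NO", just S = the vertex cover S.
Output : ℕ → Set
Output n = Maybe (List (Fin n))

-- Its entire memory is a
-- bit string (List Bool).  It knows n (vertex set is known) and the input k.
-- * init n k         : memory before the first pass
-- * step n k m e     : memory after reading edge e with memory m
-- * endPass n k m    : at the end of a pass, with memory m, either start
--                      another pass with memory m' (inj₁ m') or halt with an
--                      output (inj₂ o).  Computation is unbounded.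
record StreamingAlgorithm : Set where
  field
    init    : (n k : ℕ) → List Bool
    step    : (n k : ℕ) → List Bool → Edge n → List Bool
    endPass : (n k : ℕ) → List Bool → List Bool ⊎ Output n

open StreamingAlgorithm public

-- Returns
-- (just o) if the algorithm halted with output o within p passes, (nothing)
-- otherwise, together with the list of all memory contents ever held.
execute : (A : StreamingAlgorithm) (n k : ℕ) → ℕ → List Bool → Stream n →
          Maybe (Output n) × List (List Bool)
execute A n k zero    m es = nothing , (m ∷ [])
execute A n k (suc p) m es with endPass A n k (foldl (step A n k) m es)
... | inj₁ m' = proj₁ (execute A n k p m' es) ,
                (scanl (step A n k) m es ++ proj₂ (execute A n k p m' es))
... | inj₂ o  = just o , scanl (step A n k) m es

CorrectAnswer : ∀ {n} → ℕ → Stream n → Maybe (Output n) → Set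
CorrectAnswer k es nothing = ⊥
CorrectAnswer k es (just (just S)) = IsVertexCover es S × length S ≤ k
CorrectAnswer {n} k es (just nothing) =
  ¬ (Σ (List (Fin n)) λ S → IsVertexCover es S × length S ≤ k)

-- The algorithm explores the classical depth-k search tree for vertex cover
-- one branch per pass.  Pass j reads the k bits of j as decisions: whenever
-- an edge arrives that the vertices chosen so far do not cover, the next bit
-- says which endpoint to take; the pass fails when a (k+1)-st choice would
-- be needed.  A surviving pass has chosen a vertex cover of size at most k
-- (soundness).  Conversely, if C is a cover with |C| ≤ k, choosing each
-- time an endpoint still in C gives a surviving bit string (completeness),
-- so after 2^k failed passes the answer NO is correct.
module Submission where

open import Defs
open import Data.Bool using (Bool; true; false; if_then_else_)
open import Function using (_∘_; id)
open import Data.Fin using (Fin; toℕ; fromℕ<)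
open import Data.Fin.Properties using (toℕ<n; fromℕ<-toℕ) renaming (_≟_ to _≟ᶠ_)
open import Data.List using (List; []; _∷_; _++_; length; foldl; scanl; map; filter; splitAt; replicate)
open import Data.List.Properties using (++-assoc; ++-identityʳ; length-++; length-replicate; map-++; filter-notAll)
open import Data.List.Membership.Propositional using (_∈_)
open import Data.List.Relation.Binary.Subset.Propositional using (_⊆_)
open import Data.List.Membership.Propositional.Properties using (∈-++⁻; ∈-++⁺ˡ; ∈-++⁺ʳ; ∈-filter⁺)
open import Data.List.Relation.Unary.All as All using (All; []; _∷_)
open import Data.List.Relation.Unary.All.Properties using (++⁺; map⁺)
open import Data.List.Relation.Unary.Any as Any using (here; there)
open import Data.Maybe as Maybe using (Maybe; just; nothing; _>>=_)
open import Data.Maybe.Relation.Unary.All as MaybeAll using ()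
open import Data.Nat using (ℕ; zero; suc; _+_; _*_; _^_; _≤_; _<_; z≤n; s≤s; s≤s⁻¹; pred; ⌈_/2⌉; ⌊_/2⌋)
open import Data.Nat.Properties
open import Data.Nat.Logarithm using (⌈log₂_⌉)
open import Data.Nat.Logarithm.Core using (⌈log2⌉)
open import Data.Nat.Induction using (<-wellFounded)
open import Data.Nat.Tactic.RingSolver using (solve-∀)
open import Data.Product as Product using (Σ; ∃; _×_; _,_; proj₁; proj₂)
open import Data.Sum as Sum using (_⊎_; inj₁; inj₂; map₁)
open import Data.Unit using (⊤; tt)
open import Induction.WellFounded using (Acc; acc)
open import Relation.Nullary using (¬_; Dec; yes; no; ¬?; contradiction)
open import Relation.Nullary.Decidable using (_⊎-dec_)
open import Relation.Binary.PropositionalEquality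

-- Fixed-width binary numerals, least significant bit first.

bitValue : Bool → ℕ
bitValue false = 0
bitValue true  = 1

-- Doubling by structural recursion, so that parity and halving compute on it.
double : ℕ → ℕ
double zero    = zero
double (suc m) = suc (suc (double m))

fromBits : List Bool → ℕ
fromBits []       = 0
fromBits (b ∷ bs) = bitValue b + double (fromBits bs)

lowBit : ℕ → Bool
lowBit 0             = false
lowBit 1             = true
lowBit (suc (suc x)) = lowBit x

half : ℕ → ℕ
half 0             = 0
half 1             = 0
half (suc (suc x)) = suc (half x)

toBits : ℕ → ℕ → List Bool
toBits zero    x = []
toBits (suc w) x = lowBit x ∷ toBits w (half x)

length-toBits : ∀ w x → length (toBits w x) ≡ w
length-toBits zero    x = refl
length-toBits (suc w) x = cong suc (length-toBits w (half x))

double≡2* : ∀ m → double m ≡ 2 * m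
double≡2* zero    = refl
double≡2* (suc m) = cong suc (trans (cong suc (double≡2* m)) (sym (+-suc m (m + 0))))

lowBit+half : ∀ x → bitValue (lowBit x) + double (half x) ≡ x
lowBit+half 0             = refl
lowBit+half 1             = refl
lowBit+half (suc (suc x)) with lowBit x | lowBit+half x
... | false | eq = cong (λ y → suc (suc y)) eq
... | true  | eq = cong (λ y → suc (suc y)) eq

lowBit-cons : ∀ b m → lowBit (bitValue b + double m) ≡ b
lowBit-cons false zero    = refl
lowBit-cons true  zero    = refl
lowBit-cons false (suc m) = lowBit-cons false m
lowBit-cons true  (suc m) = lowBit-cons true m

half-cons : ∀ b m → half (bitValue b + double m) ≡ m
half-cons false zero    = refl
half-cons true  zero    = refl
half-cons false (suc m) = cong suc (half-cons false m)
half-cons true  (suc m) = cong suc (half-cons true m)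

half-< : ∀ x P → x < 2 * P → half x < P
half-< x P x<2P = *-cancelˡ-< 2 _ _ (begin-strict
  2 * half x                            ≡⟨ double≡2* (half x) ⟨
  double (half x)                       ≤⟨ m≤n+m _ (bitValue (lowBit x)) ⟩
  bitValue (lowBit x) + double (half x) ≡⟨ lowBit+half x ⟩
  x                                     <⟨ x<2P ⟩
  2 * P                                 ∎)
  where open ≤-Reasoning

fromBits-toBits : ∀ w x → x < 2 ^ w → fromBits (toBits w x) ≡ x
fromBits-toBits zero    zero    _        = refl
fromBits-toBits zero    (suc x) (s≤s ())
fromBits-toBits (suc w) x       x<2^w    =
  trans (cong (λ y → bitValue (lowBit x) + double y) (fromBits-toBits w (half x) (half-< x (2 ^ w) x<2^w)))
        (lowBit+half x)

toBits-fromBits : ∀ bs → toBits (length bs) (fromBits bs) ≡ bs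
toBits-fromBits []       = refl
toBits-fromBits (b ∷ bs) =
  cong₂ _∷_ (lowBit-cons b (fromBits bs))
            (trans (cong (toBits (length bs)) (half-cons b (fromBits bs))) (toBits-fromBits bs))

fromBits-< : ∀ bs → fromBits bs < 2 ^ length bs
fromBits-< []       = s≤s z≤n
fromBits-< (b ∷ bs) = begin-strict
  bitValue b + double v   ≤⟨ +-monoˡ-≤ (double v) (bitValue≤1 b) ⟩
  1 + double v            ≡⟨ cong suc (double≡2* v) ⟩
  1 + 2 * v               <⟨ ≤-reflexive (sym (*-suc 2 v)) ⟩
  2 * suc v               ≤⟨ *-monoʳ-≤ 2 (fromBits-< bs) ⟩
  2 * 2 ^ length bs       ∎
  where
  open ≤-Reasoning
  v = fromBits bs
  bitValue≤1 : ∀ b → bitValue b ≤ 1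
  bitValue≤1 false = z≤n
  bitValue≤1 true  = s≤s z≤n

m≤2*⌈m/2⌉ : ∀ m → m ≤ 2 * ⌈ m /2⌉
m≤2*⌈m/2⌉ m = begin
  m                         ≡⟨ ⌊n/2⌋+⌈n/2⌉≡n m ⟨
  ⌊ m /2⌋ + ⌈ m /2⌉         ≤⟨ +-monoˡ-≤ ⌈ m /2⌉ (⌊n/2⌋≤⌈n/2⌉ m) ⟩
  ⌈ m /2⌉ + ⌈ m /2⌉         ≡⟨ cong (⌈ m /2⌉ +_) (+-identityʳ ⌈ m /2⌉) ⟨
  2 * ⌈ m /2⌉               ∎
  where open ≤-Reasoning

-- Follows the recursion ⌈log2⌉ (2+m) = 1 + ⌈log2⌉ ⌈(2+m)/2⌉ of the library.
≤2^⌈log2⌉ : ∀ m (rec : Acc _<_ m) → m ≤ 2 ^ ⌈log2⌉ m rec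
≤2^⌈log2⌉ 0             _        = z≤n
≤2^⌈log2⌉ 1             _        = s≤s z≤n
≤2^⌈log2⌉ (suc (suc m)) (acc rs) =
  ≤-trans (m≤2*⌈m/2⌉ (suc (suc m))) (*-monoʳ-≤ 2 (≤2^⌈log2⌉ (suc ⌈ m /2⌉) _))

n≤2^⌈log₂n⌉ : ∀ n → n ≤ 2 ^ ⌈log₂ n ⌉
n≤2^⌈log₂n⌉ n = ≤2^⌈log2⌉ n (<-wellFounded n)

-- A code for the values of A satisfying Valid is
-- self-delimiting (decoding a code word followed by arbitrary further bits
-- returns the value and the remaining bits) and has bounded word length.
record Code (A : Set) (Valid : A → Set) : Set where
  field
    encode        : A → List Bool
    decode        : List Bool → Maybe (A × List Bool)
    width         : ℕ
    decode-encode : ∀ x rest → Valid x → decode (encode x ++ rest) ≡ just (x , rest)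
    length-encode : ∀ x → Valid x → length (encode x) ≤ width
open Code

Always : {A : Set} → A → Set
Always _ = ⊤

splitAt-++ : ∀ {A : Set} (xs ys : List A) → splitAt (length xs) (xs ++ ys) ≡ (xs , ys)
splitAt-++ []       ys = refl
splitAt-++ (x ∷ xs) ys = cong (Product.map₁ (x ∷_)) (splitAt-++ xs ys)

numeral : (w : ℕ) → Code ℕ (_< 2 ^ w)
numeral w = record
  { encode        = toBits w
  ; decode        = λ bs → just (Product.map₁ fromBits (splitAt w bs))
  ; width         = w
  ; decode-encode = roundtrip
  ; length-encode = λ x _ → ≤-reflexive (length-toBits w x)
  }
  where
  roundtrip : ∀ x rest → x < 2 ^ w →
              just (Product.map₁ fromBits (splitAt w (toBits w x ++ rest))) ≡ just (x , rest)
  roundtrip x rest x<2^w = begin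
    just (Product.map₁ fromBits (splitAt w (toBits w x ++ rest)))
      ≡⟨ cong (λ l → just (Product.map₁ fromBits (splitAt l (toBits w x ++ rest)))) (length-toBits w x) ⟨
    just (Product.map₁ fromBits (splitAt (length (toBits w x)) (toBits w x ++ rest)))
      ≡⟨ cong (just ∘ Product.map₁ fromBits) (splitAt-++ (toBits w x) rest) ⟩
    just (fromBits (toBits w x) , rest)
      ≡⟨ cong (λ y → just (y , rest)) (fromBits-toBits w x x<2^w) ⟩
    just (x , rest) ∎
    where open ≡-Reasoning

bit : Code Bool Always
bit = record
  { encode        = λ b → b ∷ []
  ; decode        = λ { [] → nothing ; (b ∷ rest) → just (b , rest) }
  ; width         = 1
  ; decode-encode = λ _ _ _ → refl
  ; length-encode = λ _ _ → ≤-refl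
  }

via : ∀ {A B : Set} {V : B → Set} (f : A → B) (g : B → Maybe A) →
      (∀ x → g (f x) ≡ just x) → Code B V → Code A (λ x → V (f x))
via {A} {B} {V} f g g∘f c = record
  { encode        = λ x → encode c (f x)
  ; decode        = dec
  ; width         = width c
  ; decode-encode = roundtrip
  ; length-encode = λ x → length-encode c (f x)
  }
  where
  dec : List Bool → Maybe (A × List Bool)
  dec bs = decode c bs >>= λ (y , rest) → Maybe.map (_, rest) (g y)
  roundtrip : ∀ x rest → V (f x) → dec (encode c (f x) ++ rest) ≡ just (x , rest)
  roundtrip x rest v rewrite decode-encode c (f x) rest v | g∘f x = refl

optional : ∀ {A : Set} {V : A → Set} → Code A V → Code (Maybe A) (MaybeAll.All V)
optional {A} {V} c = record
  { encode        = enc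
  ; decode        = dec
  ; width         = suc (width c)
  ; decode-encode = roundtrip
  ; length-encode = λ { nothing _ → s≤s z≤n ; (just x) (MaybeAll.just v) → s≤s (length-encode c x v) }
  }
  where
  enc : Maybe A → List Bool
  enc nothing  = false ∷ []
  enc (just x) = true ∷ encode c x
  dec : List Bool → Maybe (Maybe A × List Bool)
  dec (false ∷ rest) = just (nothing , rest)
  dec (true ∷ bs)    = decode c bs >>= λ (x , rest) → just (just x , rest)
  dec []             = nothing
  roundtrip : ∀ m rest → MaybeAll.All V m → dec (enc m ++ rest) ≡ just (m , rest)
  roundtrip nothing  rest _                  = refl
  roundtrip (just x) rest (MaybeAll.just v) rewrite decode-encode c x rest v = refl

list : ∀ {A : Set} {V : A → Set} (bound : ℕ) → Code A V →
       Code (List A) (λ xs → length xs ≤ bound × All V xs)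
list {A} {V} bound c = record
  { encode        = enc
  ; decode        = dec bound
  ; width         = suc (bound * suc (width c))
  ; decode-encode = λ xs rest (short , valid) → roundtrip bound xs rest short valid
  ; length-encode = λ xs (short , valid) →
      ≤-trans (length-enc xs valid) (s≤s (*-monoˡ-≤ (suc (width c)) short))
  }
  where
  enc : List A → List Bool
  enc []       = false ∷ []
  enc (x ∷ xs) = true ∷ encode c x ++ enc xs
  -- The first argument is fuel: at most that many elements are read.
  dec : ℕ → List Bool → Maybe (List A × List Bool)
  dec _       (false ∷ rest) = just ([] , rest)
  dec (suc f) (true ∷ bs)    =
    decode c bs >>= λ (x , bs′) → dec f bs′ >>= λ (xs , rest) → just (x ∷ xs , rest)
  dec _       _              = nothing
  roundtrip : ∀ f xs rest → length xs ≤ f → All V xs → dec f (enc xs ++ rest) ≡ just (xs , rest)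
  roundtrip f       []       rest _         _          = refl
  roundtrip (suc f) (x ∷ xs) rest (s≤s len) (v ∷ vs)
    rewrite ++-assoc (encode c x) (enc xs) rest
          | decode-encode c x (enc xs ++ rest) v
          | roundtrip f xs rest len vs = refl
  length-enc : ∀ xs → All V xs → length (enc xs) ≤ suc (length xs * suc (width c))
  length-enc []       []       = ≤-refl
  length-enc (x ∷ xs) (v ∷ vs) = s≤s (begin
    length (encode c x ++ enc xs)                     ≡⟨ length-++ (encode c x) ⟩
    length (encode c x) + length (enc xs)             ≤⟨ +-mono-≤ (length-encode c x v) (length-enc xs vs) ⟩
    width c + suc (length xs * suc (width c))         ≡⟨ +-suc (width c) _ ⟩
    suc (width c + length xs * suc (width c))         ∎)
    where open ≤-Reasoning

_⊗_ : ∀ {A B : Set} {V : A → Set} {W : B → Set} → Code A V → Code B W →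
      Code (A × B) (λ p → V (proj₁ p) × W (proj₂ p))
_⊗_ {A} {B} {V} {W} c d = record
  { encode        = enc
  ; decode        = dec
  ; width         = width c + width d
  ; decode-encode = roundtrip
  ; length-encode = λ (a , b) (va , vb) →
      ≤-trans (≤-reflexive (length-++ (encode c a))) (+-mono-≤ (length-encode c a va) (length-encode d b vb))
  }
  where
  enc : A × B → List Bool
  enc (a , b) = encode c a ++ encode d b
  dec : List Bool → Maybe ((A × B) × List Bool)
  dec bs = decode c bs >>= λ (a , bs′) → decode d bs′ >>= λ (b , rest) → just ((a , b) , rest)
  roundtrip : ∀ p rest → V (proj₁ p) × W (proj₂ p) → dec (enc p ++ rest) ≡ just (p , rest)
  roundtrip (a , b) rest (va , vb)
    rewrite ++-assoc (encode c a) (encode d b) rest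
          | decode-encode c a (encode d b ++ rest) va
          | decode-encode d b rest vb = refl

-- Multi-pass machines with an abstract state space.  runPasses mirrors
-- Defs.execute: the answer after at most p passes, and every state held.
module Passes {n : ℕ} {State : Set} (advance : State → Edge n → State)
              (finish : State → State ⊎ Output n) (es : Stream n) where

  runPasses : ℕ → State → Maybe (Output n) × List State
  runPasses zero    s = nothing , s ∷ []
  runPasses (suc p) s with finish (foldl advance s es)
  ... | inj₁ s′ = proj₁ (runPasses p s′) , scanl advance s es ++ proj₂ (runPasses p s′)
  ... | inj₂ o  = just o , scanl advance s es

  module Invariant (Inv : State → Set) (advance-inv : ∀ s e → Inv s → Inv (advance s e))
           (finish-inv : ∀ s s′ → Inv s → finish s ≡ inj₁ s′ → Inv s′) where

    foldl-inv : ∀ s es′ → Inv s → Inv (foldl advance s es′)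
    foldl-inv s []         i = i
    foldl-inv s (e ∷ es′) i = foldl-inv (advance s e) es′ (advance-inv s e i)

    scanl-inv : ∀ s es′ → Inv s → All Inv (scanl advance s es′)
    scanl-inv s []         i = i ∷ []
    scanl-inv s (e ∷ es′) i = i ∷ scanl-inv (advance s e) es′ (advance-inv s e i)

    runPasses-inv : ∀ p s → Inv s → All Inv (proj₂ (runPasses p s))
    runPasses-inv zero    s i = i ∷ []
    runPasses-inv (suc p) s i with finish (foldl advance s es) in eq
    ... | inj₁ s′ = ++⁺ (scanl-inv s es i)
                        (runPasses-inv p s′ (finish-inv _ s′ (foldl-inv s es i) eq))
    ... | inj₂ o  = scanl-inv s es i

    module Simulation (A : StreamingAlgorithm) (k : ℕ) (memory : State → List Bool)
      (step-sim : ∀ s e → Inv s → step A n k (memory s) e ≡ memory (advance s e))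
      (end-sim  : ∀ s → Inv s → endPass A n k (memory s) ≡ map₁ memory (finish s)) where

      foldl-sim : ∀ s es′ → Inv s → foldl (step A n k) (memory s) es′ ≡ memory (foldl advance s es′)
      foldl-sim s []         i = refl
      foldl-sim s (e ∷ es′) i rewrite step-sim s e i = foldl-sim (advance s e) es′ (advance-inv s e i)

      scanl-sim : ∀ s es′ → Inv s → scanl (step A n k) (memory s) es′ ≡ map memory (scanl advance s es′)
      scanl-sim s []         i = refl
      scanl-sim s (e ∷ es′) i rewrite step-sim s e i =
        cong (memory s ∷_) (scanl-sim (advance s e) es′ (advance-inv s e i))

      execute-sim : ∀ p s → Inv s →
        execute A n k p (memory s) es ≡ (proj₁ (runPasses p s) , map memory (proj₂ (runPasses p s)))
      execute-sim zero    s i = refl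
      execute-sim (suc p) s i
        rewrite foldl-sim s es i | end-sim (foldl advance s es) (foldl-inv s es i)
        with finish (foldl advance s es) in eq
      ... | inj₁ s′ = cong₂ _,_ (cong proj₁ later)
        (trans (cong₂ _++_ (scanl-sim s es i) (cong proj₂ later)) (sym (map-++ memory (scanl advance s es) _)))
        where
        later : execute A n k p (memory s′) es ≡ (proj₁ (runPasses p s′) , map memory (proj₂ (runPasses p s′)))
        later = execute-sim p s′ (finish-inv _ s′ (foldl-inv s es i) eq)
      ... | inj₂ o = cong (just o ,_) (scanl-sim s es i)

module Attempts {n : ℕ} where
  open import Data.List.Membership.DecPropositional (_≟ᶠ_ {n}) using (_∈?_)

  -- Remaining decision bits and chosen vertices; nothing once the attempt died.
  Attempt : Set
  Attempt = Maybe (List Bool × List (Fin n))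

  Covers : List (Fin n) → Edge n → Set
  Covers S e = proj₁ e ∈ S ⊎ proj₂ e ∈ S

  covers? : ∀ S e → Dec (Covers S e)
  covers? S (u , v) = u ∈? S ⊎-dec v ∈? S

  pick : Bool → Edge n → Fin n
  pick b (u , v) = if b then u else v

  pick-covers : ∀ b e S → Covers (pick b e ∷ S) e
  pick-covers true  (u , v) S = inj₁ (here refl)
  pick-covers false (u , v) S = inj₂ (here refl)

  branch : List Bool → List (Fin n) → Edge n → Attempt
  branch []      S e = nothing
  branch (b ∷ d) S e = just (d , pick b e ∷ S)

  extend : Attempt → Edge n → Attempt
  extend nothing        e = nothing
  extend (just (d , S)) e with covers? S e
  ... | yes _ = just (d , S)
  ... | no  _ = branch d S e

  run : Attempt → Stream n → Attempt
  run = foldl extend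

  run-nothing : ∀ es → run nothing es ≡ nothing
  run-nothing []       = refl
  run-nothing (e ∷ es) = run-nothing es

  run-sound : ∀ es d S {d′ S′} → run (just (d , S)) es ≡ just (d′ , S′) →
              IsVertexCover es S′ × S ⊆ S′
  run-sound []       d S refl = [] , id
  run-sound (e ∷ es) d S alive with covers? S e
  ... | yes covered with run-sound es d S alive
  ...   | cover , sub = Sum.map sub sub covered ∷ cover , sub
  run-sound (e ∷ es) []      S alive | no _ =
    contradiction (trans (sym (run-nothing es)) alive) λ ()
  run-sound (e ∷ es) (b ∷ d) S alive | no _ with run-sound es d (pick b e ∷ S) alive
  ...   | cover , sub = Sum.map sub sub (pick-covers b e S) ∷ cover , sub ∘ there

  Within : ℕ → Attempt → Set
  Within k nothing        = ⊤
  Within k (just (d , S)) = length d + length S ≤ k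

  extend-within : ∀ k a e → Within k a → Within k (extend a e)
  extend-within k nothing        e _ = tt
  extend-within k (just (d , S)) e w with covers? S e
  ... | yes _ = w
  extend-within k (just ([]    , S)) e w | no _ = tt
  extend-within k (just (b ∷ d , S)) e w | no _ = ≤-trans (≤-reflexive (+-suc (length d) (length S))) w

  run-within : ∀ k a es → Within k a → Within k (run a es)
  run-within k a []       w = w
  run-within k a (e ∷ es) w = run-within k (extend a e) es (extend-within k a e w)

  without : Fin n → List (Fin n) → List (Fin n)
  without x = filter (λ y → ¬? (y ≟ᶠ x))

  without-shorter : ∀ {x U} → x ∈ U → length (without x U) < length U
  without-shorter x∈U = filter-notAll (λ y → ¬? (y ≟ᶠ _)) _ (Any.map (λ x≡y y≢x → y≢x (sym x≡y)) x∈U)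

  move : ∀ x S U → S ++ U ⊆ (x ∷ S) ++ without x U
  move x S U {y} y∈ with ∈-++⁻ S y∈
  ... | inj₁ y∈S = there (∈-++⁺ˡ y∈S)
  ... | inj₂ y∈U with y ≟ᶠ x
  ...   | yes refl = here refl
  ...   | no  y≢x  = there (∈-++⁺ʳ S (∈-filter⁺ (λ z → ¬? (z ≟ᶠ x)) y∈U y≢x))

  reserve-endpoint : ∀ S U e → Covers (S ++ U) e → ¬ Covers S e → ∃ λ b → pick b e ∈ U
  reserve-endpoint S U (u , v) (inj₁ u∈) uncovered with ∈-++⁻ S u∈
  ... | inj₁ u∈S = contradiction (inj₁ u∈S) uncovered
  ... | inj₂ u∈U = true , u∈U
  reserve-endpoint S U (u , v) (inj₂ v∈) uncovered with ∈-++⁻ S v∈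
  ... | inj₁ v∈S = contradiction (inj₂ v∈S) uncovered
  ... | inj₂ v∈U = false , v∈U

  -- Completeness: if the chosen vertices S together with a reserve U cover
  -- the rest of the stream, then r ≥ |U| decision bits can be chosen so
  -- that the attempt survives (always pick an endpoint from the reserve).
  survive : ∀ es S U r → IsVertexCover es (S ++ U) → length U ≤ r →
            ∃ λ d → length d ≡ r × run (just (d , S)) es ≢ nothing
  survive []       S U r _ _ = replicate r false , length-replicate r , λ ()
  survive (e ∷ es) S U r (covered ∷ cover) |U|≤r with covers? S e
  ... | yes _         = survive es S U r cover |U|≤r
  ... | no  uncovered with reserve-endpoint S U e covered uncovered
  ...   | b , x∈U with r | ≤-trans (without-shorter x∈U) |U|≤r
  ...     | suc r′ | s≤s shorter
    with survive es (pick b e ∷ S) (without (pick b e) U) r′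
                 (All.map (Sum.map (move (pick b e) S U) (move (pick b e) S U)) cover) shorter
  ...       | d , |d|≡r′ , alive = b ∷ d , cong suc |d|≡r′ , alive

toFin? : ∀ {n} → ℕ → Maybe (Fin n)
toFin? {n} x with x <? n
... | yes x<n = just (fromℕ< x<n)
... | no  _   = nothing

toFin?-toℕ : ∀ {n} (v : Fin n) → toFin? (toℕ v) ≡ just v
toFin?-toℕ {n} v with toℕ v <? n
... | yes v<n = cong just (fromℕ<-toℕ v v<n)
... | no  v≮n = contradiction (toℕ<n v) v≮n

vertex : (n : ℕ) → Code (Fin n) (λ v → toℕ v < 2 ^ ⌈log₂ n ⌉)
vertex n = via toℕ toFin? toFin?-toℕ (numeral ⌈log₂ n ⌉)

-- The memory holds j and the
-- current attempt: k + O(k) + O(k log n) bits.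
module Algorithm (n k : ℕ) where
  open Attempts {n}

  State : Set
  State = ℕ × Attempt

  start : ℕ → State
  start j = j , just (toBits k j , [])

  advance : State → Edge n → State
  advance (j , a) e = j , extend a e

  finish : State → State ⊎ Output n
  finish (j , just (_ , S)) = inj₂ (just S)
  finish (j , nothing) with suc j ≟ 2 ^ k
  ... | yes _ = inj₂ nothing
  ... | no  _ = inj₁ (start (suc j))

  Inv : State → Set
  Inv (j , a) = j < 2 ^ k × Within k a

  start-within : ∀ j → Within k (just (toBits k j , []))
  start-within j = ≤-reflexive (trans (+-identityʳ _) (length-toBits k j))

  advance-inv : ∀ s e → Inv s → Inv (advance s e)
  advance-inv (j , a) e (j< , within) = j< , extend-within k a e within

  finish-inv : ∀ s s′ → Inv s → finish s ≡ inj₁ s′ → Inv s′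
  finish-inv (j , nothing) s′ (j< , _) restart with suc j ≟ 2 ^ k
  finish-inv (j , nothing) s′ (j< , _) ()      | yes _
  finish-inv (j , nothing) _  (j< , _) refl    | no  last = ≤∧≢⇒< j< last , start-within (suc j)
  finish-inv (j , just _)  s′ _        ()

  ValidAttempt : List Bool × List (Fin n) → Set
  ValidAttempt b = (length (proj₁ b) ≤ k × All Always (proj₁ b))
                 × (length (proj₂ b) ≤ k × All (λ v → toℕ v < 2 ^ ⌈log₂ n ⌉) (proj₂ b))

  stateCode : Code State (λ s → proj₁ s < 2 ^ k × MaybeAll.All ValidAttempt (proj₂ s))
  stateCode = numeral k ⊗ optional (list k bit ⊗ list k (vertex n))

  valid : ∀ s → Inv s → proj₁ s < 2 ^ k × MaybeAll.All ValidAttempt (proj₂ s)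
  valid (j , nothing)      (j< , _)      = j< , MaybeAll.nothing
  valid (j , just (d , S)) (j< , within) = j< , MaybeAll.just
    ( (m+n≤o⇒m≤o (length d) within , All.universal _ d)
    , (m+n≤o⇒n≤o (length d) within , All.universal (λ v → ≤-trans (toℕ<n v) (n≤2^⌈log₂n⌉ n)) S))

  -- Malformed memory never occurs; decoding then falls back to an arbitrary state.
  decodeState : List Bool → State
  decodeState m = Maybe.maybe proj₁ (start 0) (decode stateCode m)

  decodeState-encode : ∀ s → Inv s → decodeState (encode stateCode s) ≡ s
  decodeState-encode s i =
    cong (Maybe.maybe proj₁ (start 0))
      (trans (cong (decode stateCode) (sym (++-identityʳ (encode stateCode s))))
             (decode-encode stateCode s [] (valid s i)))

  module Run (es : Stream n) where
    open Passes advance finish es public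

    attempt : ℕ → Attempt
    attempt j = run (just (toBits k j , [])) es

    foldl-advance : ∀ j a es′ → foldl advance (j , a) es′ ≡ (j , run a es′)
    foldl-advance j a []         = refl
    foldl-advance j a (e ∷ es′) = foldl-advance j (extend a e) es′

    -- By completeness, if all 2^k attempts die there is no cover of size ≤ k.
    all-die⇒no-cover : (∀ j → j < 2 ^ k → attempt j ≡ nothing) →
                       ¬ Σ (List (Fin n)) λ C → IsVertexCover es C × length C ≤ k
    all-die⇒no-cover dead (C , cover , |C|≤k) with survive es [] C k cover |C|≤k
    ... | d , refl , alive =
      alive (subst (λ d′ → run (just (d′ , [])) es ≡ nothing) (toBits-fromBits d)
                   (dead (fromBits d) (fromBits-< d)))

    dead-extend : ∀ j → (∀ i → i < j → attempt i ≡ nothing) → attempt j ≡ nothing →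
                  ∀ i → i < suc j → attempt i ≡ nothing
    dead-extend j dead deadʲ i i<1+j with m≤n⇒m<n∨m≡n (s≤s⁻¹ i<1+j)
    ... | inj₁ i<j  = dead i i<j
    ... | inj₂ refl = deadʲ

    -- If the attempts before pass j all died, the remaining p+1 = 2^k − j
    -- passes produce a correct answer.
    answer-correct : ∀ p j → suc p + j ≡ 2 ^ k → (∀ i → i < j → attempt i ≡ nothing) →
                     CorrectAnswer k es (proj₁ (runPasses (suc p) (start j)))
    answer-correct p j total dead
      rewrite foldl-advance j (just (toBits k j , [])) es
      with run (just (toBits k j , [])) es in survivor
    ... | just (d , S) =
      proj₁ (run-sound es (toBits k j) [] survivor) ,
      m+n≤o⇒n≤o (length d) (subst (Within k) survivor (run-within k _ es (start-within j)))
    ... | nothing with suc j ≟ 2 ^ k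
    ...   | yes last = all-die⇒no-cover λ i i<2^k →
              dead-extend j dead survivor i (subst (i <_) (sym last) i<2^k)
    answer-correct zero     j total dead | nothing | no notLast = contradiction total notLast
    answer-correct (suc p) j total dead | nothing | no notLast =
      answer-correct p (suc j) (trans (cong suc (+-suc p j)) total) (dead-extend j dead survivor)

algorithm : StreamingAlgorithm
algorithm = record
  { init    = λ n k → encode (stateCode n k) (start n k 0)
  ; step    = λ n k m e → encode (stateCode n k) (advance n k (decodeState n k m) e)
  ; endPass = λ n k m → map₁ (encode (stateCode n k)) (finish n k (decodeState n k m))
  }
  where open Algorithm

module Execution (n k : ℕ) (es : Stream n) where
  open Algorithm n k public
  open Run es public

  start-inv : Inv (start 0)
  start-inv = m^n>0 2 k , start-within 0

  open Invariant Inv advance-inv finish-inv public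
  open Simulation algorithm k (encode stateCode)
    (λ s e i → cong (λ s′ → encode stateCode (advance s′ e)) (decodeState-encode s i))
    (λ s i → cong (λ s′ → map₁ (encode stateCode) (finish s′)) (decodeState-encode s i))
    public

  width-bound : 1 ≤ k → width stateCode ≤ 7 * k * (⌈log₂ n ⌉ + 1)
  width-bound (s≤s {n = k′} _) = ≤-trans (m≤m+n _ _) (≤-reflexive (sym (identity k′ ⌈log₂ n ⌉)))
    where
    identity : ∀ k′ w → 7 * suc k′ * (w + 1)
                      ≡ (suc k′ + suc (suc (suc k′ * 2) + suc (suc k′ * suc w))) + (3 * k′ + 6 * suc k′ * w)
    identity = solve-∀

  memory-bound : 1 ≤ k → ∀ {s} → Inv s → length (encode stateCode s) ≤ 7 * k * (⌈log₂ n ⌉ + 1)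
  memory-bound 1≤k {s} i = ≤-trans (length-encode stateCode s (valid s i)) (width-bound 1≤k)

  answer : CorrectAnswer k es (proj₁ (runPasses (2 ^ k) (start 0)))
  answer = subst (λ p → CorrectAnswer k es (proj₁ (runPasses p (start 0)))) passes
             (answer-correct (pred (2 ^ k)) 0 (trans (+-identityʳ _) passes) λ _ ())
    where
    passes : suc (pred (2 ^ k)) ≡ 2 ^ k
    passes = suc-pred (2 ^ k) {{m^n≢0 2 k}}

theorem4 : Σ StreamingAlgorithm λ A → Σ ℕ λ C →
    (n k : ℕ) → 1 ≤ k → (es : Stream n) → SimpleGraphStream es →
      CorrectAnswer k es (proj₁ (execute A n k (2 ^ k) (init A n k) es))
      × All (λ m → length m ≤ C * k * (⌈log₂ n ⌉ + 1))
            (proj₂ (execute A n k (2 ^ k) (init A n k) es))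
theorem4 = algorithm , 7 , λ n k 1≤k es _ →
  let open Execution n k es in
  subst (λ r → CorrectAnswer k es (proj₁ r) × All (λ m → length m ≤ 7 * k * (⌈log₂ n ⌉ + 1)) (proj₂ r))
        (sym (execute-sim (2 ^ k) (start 0) start-inv))
        (answer , map⁺ (All.map (memory-bound 1≤k) (runPasses-inv (2 ^ k) (start 0) start-inv)))
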